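{- Let $G$ and $H$ be two non-trivial graphs. Then $\varpi(G\oplus H)\ge \max\{(\varpi(G)-1)\omega(H),(\varpi(H)-1)\omega(G)\}+1$. Moreover, if there exists a twins-free clique of $G$ of cardinality $\varpi(G)$ containing no vertex of degree $|V(G)|-1$, then $\varpi(G\oplus H)\ge \varpi(G)\omega(H)$.
   Context: All graphs are finite and simple; non-trivial means at least two vertices. $\omega$ denotes the clique number. A twins-free clique is a clique $X$ such that $N_G[u]\ne N_G[v]$ for all distinct $u,v\in X$; $\varpi(G)$ is the maximum cardinality of a twins-free clique. The Cartesian sum $G\oplus H$ of $G=(V_1,E_1)$ and $H=(V_2,E_2)$ has vertex set $V_1\times V_2$, with $(a,b)(c,d)$ an edge iff $ac\in E_1$ or $bd\in E_2$. -}

module Defs where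

open import Data.Nat using (ℕ; _≤_; _*_; _∸_; _⊔_; _+_)
open import Data.Bool using (Bool; true; false; _∨_)
open import Data.Fin using (Fin; _≟_; remQuot)
open import Data.Fin.Subset using (Subset; _∈_; ∣_∣)
open import Data.Vec using (tabulate)
open import Data.Product using (Σ; _×_; _,_; proj₁; proj₂)
open import Relation.Binary.PropositionalEquality using (_≡_; _≢_; cong₂)
open import Relation.Nullary using (¬_)
open import Relation.Nullary.Decidable using (⌊_⌋)

record Graph : Set where
  field
    n      : ℕ
    adj    : Fin n → Fin n → Bool
    sym    : ∀ u v → adj u v ≡ adj v u
    irrefl : ∀ v → adj v v ≡ false
open Graph public

NonTrivial : Graph → Set
NonTrivial G = 2 ≤ n G

closedNbhd : (G : Graph) → Fin (n G) → Subset (n G)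
closedNbhd G v = tabulate (λ w → ⌊ w ≟ v ⌋ ∨ adj G v w)

degree : (G : Graph) → Fin (n G) → ℕ
degree G v = ∣ tabulate (adj G v) ∣

IsClique : (G : Graph) → Subset (n G) → Set
IsClique G X = ∀ u v → u ∈ X → v ∈ X → u ≢ v → adj G u v ≡ true

IsTwinsFreeClique : (G : Graph) → Subset (n G) → Set
IsTwinsFreeClique G X =
  IsClique G X × (∀ u v → u ∈ X → v ∈ X → u ≢ v → closedNbhd G u ≢ closedNbhd G v)

IsMaxCard : ∀ {m} → (Subset m → Set) → ℕ → Set
IsMaxCard {m} P k = Σ (Subset m) (λ X → P X × ∣ X ∣ ≡ k) × (∀ X → P X → ∣ X ∣ ≤ k)

IsCliqueNumber : (G : Graph) → ℕ → Set
IsCliqueNumber G = IsMaxCard (IsClique G)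

IsTwinsFreeCliqueNumber : (G : Graph) → ℕ → Set
IsTwinsFreeCliqueNumber G = IsMaxCard (IsTwinsFreeClique G)

-- Cartesian sum G ⊕ H on Fin (n G * n H) ≅ Fin (n G) × Fin (n H)
-- (vertex pairs encoded via remQuot / combine):
-- (a,b) ~ (c,d)  iff  ac ∈ E(G) or bd ∈ E(H).
⊕adj : (G H : Graph) → Fin (n G * n H) → Fin (n G * n H) → Bool
⊕adj G H x y =
  adj G (proj₁ (remQuot {n G} (n H) x)) (proj₁ (remQuot {n G} (n H) y))
  ∨ adj H (proj₂ (remQuot {n G} (n H) x)) (proj₂ (remQuot {n G} (n H) y))

_⊕_ : Graph → Graph → Graph
G ⊕ H = record
  { n      = n G * n H
  ; adj    = ⊕adj G H
  ; sym    = λ x y → cong₂ _∨_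
      (Graph.sym G (proj₁ (remQuot {n G} (n H) x)) (proj₁ (remQuot {n G} (n H) y)))
      (Graph.sym H (proj₂ (remQuot {n G} (n H) x)) (proj₂ (remQuot {n G} (n H) y)))
  ; irrefl = λ x → cong₂ _∨_
      (Graph.irrefl G (proj₁ (remQuot {n G} (n H) x)))
      (Graph.irrefl H (proj₂ (remQuot {n G} (n H) x)))
  }

-- In G ⊕ H take the rows {a} × Y for a in a twins-free clique X of G, with Y a clique of H.
-- This is a clique, and it is twins-free as long as each row with two vertices sits over a
-- non-universal vertex a: distinct G-coordinates in X are separated by a vertex of G, and
-- (a, b), (a, b′) are separated by (c, b′) for any c not adjacent to a. Universal vertices are
-- pairwise twins, so X has at most one, x₀; cutting its row down to a single vertex gives
-- (ϖ(G) − 1) ω(H) + 1, symmetrically (ϖ(H) − 1) ω(G) + 1, and if X has no universal vertex the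
-- full product X × Y gives ϖ(G) ω(H).
module Submission where

open import Defs hiding (sym; irrefl)
open import Data.Nat using (ℕ; zero; suc; _+_; _*_; _∸_; _⊔_; _≤_; s≤s; z≤n)
open import Data.Nat.Properties
  using (+-0-commutativeMonoid; +-assoc; +-comm; +-cancelˡ-≡; +-distribʳ-⊔; ⊔-lub; ≤-trans)
open import Algebra.Properties.CommutativeMonoid.Sum +-0-commutativeMonoid
  using (sum-syntax; sum-cong-≗; sum-remove; ∑-comm)
open import Data.Bool using (Bool; true; false; _∨_; if_then_else_)
open import Data.Bool.Properties using (∨-comm; ∨-zeroʳ; ∨-identityʳ)
open import Data.Fin using (Fin; zero; suc; _≟_; remQuot; combine; _↑ˡ_; _↑ʳ_; punchIn)
open import Data.Fin.Properties using (remQuot-combine; combine-remQuot; punchInᵢ≢i; all?; any?)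
open import Data.Fin.Subset using (Subset; _∈_; _⊆_; ∣_∣; ⊥; ⁅_⁆; ∁; Nonempty)
open import Data.Fin.Subset.Properties
  using (_∈?_; ⊆-antisym; x∈⁅y⁆⇒x≡y; x∈⁅x⁆; ∣⁅x⁆∣≡1; ∣⊥∣≡0; ∉⊥; ∣∁p∣≡n∸∣p∣;
         x∉p⇒x∈∁p; x∈∁p⇒x∉p; nonempty?; Empty-unique; x∈p⇒∣p-x∣<∣p∣)
open import Data.Vec using (tabulate; lookup; _∷_; [])
open import Data.Vec.Properties using (lookup∘tabulate; tabulate∘lookup; lookup⇒[]=; []=⇒lookup)
open import Data.Vec.Functional using (updateAt)
open import Data.Vec.Functional.Properties using (updateAt-updates; updateAt-minimal)
open import Data.Product using (Σ; _×_; _,_; proj₁; proj₂)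
open import Data.Sum using (_⊎_; inj₁; inj₂)
open import Function using (_∘_)
open import Relation.Binary.PropositionalEquality
open import Relation.Nullary using (¬_; Dec; yes; no; contradiction; _×-dec_)
open import Relation.Nullary.Decidable using (isYes≗does; dec-true)


indicator : Bool → ℕ
indicator true  = 1
indicator false = 0

∣tabulate∣≡∑ : ∀ {m} (f : Fin m → Bool) → ∣ tabulate f ∣ ≡ ∑[ i < m ] indicator (f i)
∣tabulate∣≡∑ {zero}  f = refl
∣tabulate∣≡∑ {suc m} f with f zero
... | true  = cong suc (∣tabulate∣≡∑ (f ∘ suc))
... | false = ∣tabulate∣≡∑ (f ∘ suc)

∣p∣≡∑ : ∀ {m} (p : Subset m) → ∣ p ∣ ≡ ∑[ i < m ] indicator (lookup p i)
∣p∣≡∑ p = trans (cong ∣_∣ (sym (tabulate∘lookup p))) (∣tabulate∣≡∑ (lookup p))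

∑-↑ : ∀ k {l} (h : Fin (k + l) → ℕ) →
      ∑[ z < k + l ] h z ≡ ∑[ j < k ] h (j ↑ˡ l) + ∑[ z < l ] h (k ↑ʳ z)
∑-↑ zero    h = refl
∑-↑ (suc k) h = trans (cong (h zero +_) (∑-↑ k (h ∘ suc))) (sym (+-assoc (h zero) _ _))

∑-combine : ∀ m {k} (h : Fin (m * k) → ℕ) →
            ∑[ z < m * k ] h z ≡ ∑[ i < m ] ∑[ j < k ] h (combine i j)
∑-combine zero    h = refl
∑-combine (suc m) {k} h =
  trans (∑-↑ k h) (cong (∑[ j < k ] h (j ↑ˡ (m * k)) +_) (∑-combine m (h ∘ (k ↑ʳ_))))

∑-updateAt : ∀ {A : Set} {m} (h : A → ℕ) (R : Fin m → A) i z →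
             h (R i) + ∑[ a < m ] h (updateAt R i (λ _ → z) a) ≡ ∑[ a < m ] h (R a) + h z
∑-updateAt {A} {suc m} h R i z = begin
  h (R i) + ∑[ a < suc m ] h (R′ a)                 ≡⟨ cong (h (R i) +_) (sum-remove {i = i} (h ∘ R′)) ⟩
  h (R i) + (h (R′ i) + ∑[ j < m ] h (R′ (punchIn i j)))
    ≡⟨ cong₂ (λ x y → h (R i) + (h x + y)) (updateAt-updates i R) (sum-cong-≗ unchanged) ⟩
  h (R i) + (h z + rest)                            ≡⟨ cong (h (R i) +_) (+-comm (h z) rest) ⟩
  h (R i) + (rest + h z)                            ≡⟨ sym (+-assoc (h (R i)) rest (h z)) ⟩
  (h (R i) + rest) + h z                            ≡⟨ cong (_+ h z) (sym (sum-remove {i = i} (h ∘ R))) ⟩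
  ∑[ a < suc m ] h (R a) + h z                      ∎
  where
  open ≡-Reasoning
  R′ : Fin (suc m) → A
  R′ = updateAt R i (λ _ → z)
  rest : ℕ
  rest = ∑[ j < m ] h (R (punchIn i j))
  unchanged : ∀ j → h (R′ (punchIn i j)) ≡ h (R (punchIn i j))
  unchanged j = cong h (updateAt-minimal (punchIn i j) i R (punchInᵢ≢i i j))

w+s≡k*w+1⇒s≡[k∸1]*w+1 : ∀ {k w s} → 1 ≤ k → w + s ≡ k * w + 1 → s ≡ (k ∸ 1) * w + 1
w+s≡k*w+1⇒s≡[k∸1]*w+1 {suc k} {w} {s} _ eq =
  +-cancelˡ-≡ w s (k * w + 1) (trans eq (+-assoc w (k * w) 1))


∈-tabulate⁺ : ∀ {m} {f : Fin m → Bool} {x} → f x ≡ true → x ∈ tabulate f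
∈-tabulate⁺ {f = f} {x} fx = lookup⇒[]= x (tabulate f) (trans (lookup∘tabulate f x) fx)

∈-tabulate⁻ : ∀ {m} {f : Fin m → Bool} {x} → x ∈ tabulate f → f x ≡ true
∈-tabulate⁻ {f = f} {x} x∈ = trans (sym (lookup∘tabulate f x)) ([]=⇒lookup x∈)

1≤∣p∣⇒Nonempty : ∀ {m} (p : Subset m) → 1 ≤ ∣ p ∣ → Nonempty p
1≤∣p∣⇒Nonempty {m} p 1≤∣p∣ with nonempty? p
... | yes p≠∅ = p≠∅
... | no  p=∅ = contradiction (subst (1 ≤_) (trans (cong ∣_∣ (Empty-unique p=∅)) (∣⊥∣≡0 m)) 1≤∣p∣) λ ()

∈⁅⁆-unique : ∀ {m} {x u v : Fin m} → u ∈ ⁅ x ⁆ → v ∈ ⁅ x ⁆ → u ≡ v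
∈⁅⁆-unique {x = x} u∈ v∈ = trans (x∈⁅y⁆⇒x≡y x u∈) (sym (x∈⁅y⁆⇒x≡y x v∈))

-- Row a of the product set X × Y.
_⊗_ : ∀ {m k} → Subset m → Subset k → Fin m → Subset k
(X ⊗ Y) a = if lookup X a then Y else ⊥

∈-⊗⁻ : ∀ {m k} {X : Subset m} {Y : Subset k} {a b} → b ∈ (X ⊗ Y) a → a ∈ X × b ∈ Y
∈-⊗⁻ {X = X} {a = a} b∈ with lookup X a in eq
... | true  = lookup⇒[]= a X eq , b∈
... | false = contradiction b∈ ∉⊥

⊗-≡ : ∀ {m k} {X : Subset m} {Y : Subset k} {a} → a ∈ X → (X ⊗ Y) a ≡ Y
⊗-≡ {Y = Y} a∈X = cong (if_then Y else ⊥) ([]=⇒lookup a∈X)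

∑-⊗ : ∀ {m k} (X : Subset m) (Y : Subset k) → ∑[ a < m ] ∣ (X ⊗ Y) a ∣ ≡ ∣ X ∣ * ∣ Y ∣
∑-⊗ []          Y = refl
∑-⊗ (true ∷ X)  Y = cong (∣ Y ∣ +_) (∑-⊗ X Y)
∑-⊗ {k = k} (false ∷ X) Y = cong₂ _+_ (∣⊥∣≡0 k) (∑-⊗ X Y)


module _ (G : Graph) where

  ∈-closedNbhd⁺ : ∀ {v w} → w ≡ v ⊎ adj G v w ≡ true → w ∈ closedNbhd G v
  ∈-closedNbhd⁺ {v} {w} (inj₁ w≡v) =
    ∈-tabulate⁺ (cong (_∨ adj G v w) (trans (isYes≗does (w ≟ v)) (dec-true (w ≟ v) w≡v)))
  ∈-closedNbhd⁺ {v} {w} (inj₂ v~w) = ∈-tabulate⁺ (trans (cong (_ ∨_) v~w) (∨-zeroʳ _))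

  ∈-closedNbhd⁻ : ∀ {v w} → w ∈ closedNbhd G v → w ≡ v ⊎ adj G v w ≡ true
  ∈-closedNbhd⁻ {v} {w} w∈ with w ≟ v | ∈-tabulate⁻ w∈
  ... | yes w≡v | _   = inj₁ w≡v
  ... | no  _   | v~w = inj₂ v~w

  Universal : Fin (n G) → Set
  Universal v = ∀ w → w ∈ closedNbhd G v

  universal? : ∀ v → Dec (Universal v)
  universal? v = all? (_∈? closedNbhd G v)

  universal-twins : ∀ {u v} → Universal u → Universal v → closedNbhd G u ≡ closedNbhd G v
  universal-twins u-univ v-univ = ⊆-antisym (λ {w} _ → v-univ w) (λ {w} _ → u-univ w)

  universal⇒degree : ∀ v → Universal v → degree G v ≡ n G ∸ 1
  universal⇒degree v v-univ = begin
    ∣ tabulate (adj G v) ∣  ≡⟨ cong ∣_∣ (⊆-antisym nbhd⊆ ⊆nbhd) ⟩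
    ∣ ∁ ⁅ v ⁆ ∣             ≡⟨ ∣∁p∣≡n∸∣p∣ ⁅ v ⁆ ⟩
    n G ∸ ∣ ⁅ v ⁆ ∣         ≡⟨ cong (n G ∸_) (∣⁅x⁆∣≡1 v) ⟩
    n G ∸ 1                 ∎
    where
    open ≡-Reasoning
    nbhd⊆ : tabulate (adj G v) ⊆ ∁ ⁅ v ⁆
    nbhd⊆ {w} w∈ = x∉p⇒x∈∁p λ w∈⁅v⁆ → contradiction
      (trans (sym (∈-tabulate⁻ w∈)) (trans (cong (adj G v) (x∈⁅y⁆⇒x≡y v w∈⁅v⁆)) (Graph.irrefl G v)))
      λ ()
    ⊆nbhd : ∁ ⁅ v ⁆ ⊆ tabulate (adj G v)
    ⊆nbhd {w} w∈∁ with ∈-closedNbhd⁻ (v-univ w)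
    ... | inj₁ w≡v = contradiction (subst (_∈ ⁅ v ⁆) (sym w≡v) (x∈⁅x⁆ v)) (x∈∁p⇒x∉p w∈∁)
    ... | inj₂ v~w = ∈-tabulate⁺ v~w

  ⁅⁆-isClique : ∀ v → IsClique G ⁅ v ⁆
  ⁅⁆-isClique v u w u∈ w∈ u≢w = contradiction (∈⁅⁆-unique u∈ w∈) u≢w

  ⁅⁆-isTwinsFreeClique : ∀ v → IsTwinsFreeClique G ⁅ v ⁆
  ⁅⁆-isTwinsFreeClique v =
    ⁅⁆-isClique v , λ u w u∈ w∈ u≢w → contradiction (∈⁅⁆-unique u∈ w∈) u≢w

  1≤ϖ : ∀ {k} → IsTwinsFreeCliqueNumber G k → Fin (n G) → 1 ≤ k
  1≤ϖ (_ , maximal) v = subst (_≤ _) (∣⁅x⁆∣≡1 v) (maximal ⁅ v ⁆ (⁅⁆-isTwinsFreeClique v))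

  -- Two universal vertices are twins, so a twins-free clique contains at most one.
  nonUniversal-except-one : ∀ {X x} → IsTwinsFreeClique G X → x ∈ X →
    Σ (Fin (n G)) λ x₀ → x₀ ∈ X × (∀ a → a ∈ X → a ≢ x₀ → ¬ Universal a)
  nonUniversal-except-one {X} {x} (_ , twinsFree) x∈X with any? (λ a → (a ∈? X) ×-dec universal? a)
  ... | yes (u , u∈X , u-univ) =
    u , u∈X , λ a a∈X a≢u a-univ → twinsFree a u a∈X u∈X a≢u (universal-twins a-univ u-univ)
  ... | no none = x , x∈X , λ a a∈X _ a-univ → none (a , a∈X , a-univ)


-- Rather than bijectivity of pair, only its consequence ∑-pair (reindexing of sums) is recorded.
record IsCartesianSum (G H K : Graph) : Set where
  field
    pair     : Fin (n G) → Fin (n H) → Fin (n K)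
    fst      : Fin (n K) → Fin (n G)
    snd      : Fin (n K) → Fin (n H)
    fst-pair : ∀ a b → fst (pair a b) ≡ a
    snd-pair : ∀ a b → snd (pair a b) ≡ b
    pair-η   : ∀ z → pair (fst z) (snd z) ≡ z
    adj-≡    : ∀ z w → adj K z w ≡ adj G (fst z) (fst w) ∨ adj H (snd z) (snd w)
    ∑-pair   : ∀ (h : Fin (n K) → ℕ) →
               ∑[ z < n K ] h z ≡ ∑[ a < n G ] ∑[ b < n H ] h (pair a b)

⊕-isCartesianSum : ∀ G H → IsCartesianSum G H (G ⊕ H)
⊕-isCartesianSum G H = record
  { pair     = combine
  ; fst      = λ z → proj₁ (remQuot {n G} (n H) z)
  ; snd      = λ z → proj₂ (remQuot {n G} (n H) z)
  ; fst-pair = λ a b → cong proj₁ (remQuot-combine a b)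
  ; snd-pair = λ a b → cong proj₂ (remQuot-combine a b)
  ; pair-η   = combine-remQuot {n G} (n H)
  ; adj-≡    = λ _ _ → refl
  ; ∑-pair   = ∑-combine (n G)
  }

IsCartesianSum-swap : ∀ {G H K} → IsCartesianSum G H K → IsCartesianSum H G K
IsCartesianSum-swap {G} {H} C = record
  { pair     = λ b a → pair a b
  ; fst      = snd
  ; snd      = fst
  ; fst-pair = λ b a → snd-pair a b
  ; snd-pair = λ b a → fst-pair a b
  ; pair-η   = pair-η
  ; adj-≡    = λ z w → trans (adj-≡ z w) (∨-comm (adj G (fst z) (fst w)) _)
  ; ∑-pair   = λ h → trans (∑-pair h) (∑-comm (λ a b → h (pair a b)))
  }
  where open IsCartesianSum C

module CartesianSum {G H K : Graph} (C : IsCartesianSum G H K) where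
  open IsCartesianSum C

  snd-≢ : ∀ {u v} → u ≢ v → fst u ≡ fst v → snd u ≢ snd v
  snd-≢ {u} {v} u≢v fst≡ snd≡ = u≢v (begin
    u                   ≡⟨ sym (pair-η u) ⟩
    pair (fst u) (snd u) ≡⟨ cong₂ pair fst≡ snd≡ ⟩
    pair (fst v) (snd v) ≡⟨ pair-η v ⟩
    v                   ∎)
    where open ≡-Reasoning

  adj-fst : ∀ {u v} → adj G (fst u) (fst v) ≡ true → adj K u v ≡ true
  adj-fst {u} {v} a~a′ = trans (adj-≡ u v) (cong (_∨ adj H (snd u) (snd v)) a~a′)

  adj-snd : ∀ {u v} → adj H (snd u) (snd v) ≡ true → adj K u v ≡ true
  adj-snd {u} {v} b~b′ =
    trans (adj-≡ u v) (trans (cong (adj G (fst u) (fst v) ∨_) b~b′) (∨-zeroʳ _))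

  -- On the G-fibre through v, N_K[v] is N_G[fst v]: the H-term vanishes as H is irreflexive.
  ∈-closedNbhd-fibre : ∀ {v c} → pair c (snd v) ∈ closedNbhd K v → c ∈ closedNbhd G (fst v)
  ∈-closedNbhd-fibre {v} {c} w∈ with ∈-closedNbhd⁻ K w∈
  ... | inj₁ w≡v = ∈-closedNbhd⁺ G (inj₁ (trans (sym (fst-pair c (snd v))) (cong fst w≡v)))
  ... | inj₂ v~w = ∈-closedNbhd⁺ G (inj₂ (begin
    adj G (fst v) c                                                     ≡⟨ ∨-identityʳ _ ⟨
    adj G (fst v) c ∨ false                                             ≡⟨ cong (_ ∨_) (Graph.irrefl H (snd v)) ⟨
    adj G (fst v) c ∨ adj H (snd v) (snd v)                             ≡⟨ cong₂ (λ x y → adj G (fst v) x ∨ adj H (snd v) y)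
                                                                             (fst-pair c (snd v)) (snd-pair c (snd v)) ⟨
    adj G (fst v) (fst (pair c (snd v))) ∨ adj H (snd v) (snd (pair c (snd v))) ≡⟨ adj-≡ v _ ⟨
    adj K v (pair c (snd v))                                            ≡⟨ v~w ⟩
    true                                                                ∎))
    where open ≡-Reasoning

  twins⇒closedNbhd-fst-⊆ : ∀ {u v} → adj G (fst u) (fst v) ≡ true →
    closedNbhd K u ≡ closedNbhd K v → closedNbhd G (fst u) ⊆ closedNbhd G (fst v)
  twins⇒closedNbhd-fst-⊆ {u} {v} a~a′ N≡ {c} c∈ with ∈-closedNbhd⁻ G c∈
  ... | inj₁ refl = ∈-closedNbhd⁺ G (inj₂ (trans (Graph.sym G _ _) a~a′))
  ... | inj₂ a~c  = ∈-closedNbhd-fibre (subst (pair c (snd v) ∈_) N≡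
    (∈-closedNbhd⁺ K (inj₂ (adj-fst (trans (cong (adj G (fst u)) (fst-pair c (snd v))) a~c)))))

  twins⇒twins-fst : ∀ {u v} → adj G (fst u) (fst v) ≡ true →
    closedNbhd K u ≡ closedNbhd K v → closedNbhd G (fst u) ≡ closedNbhd G (fst v)
  twins⇒twins-fst a~a′ N≡ = ⊆-antisym (twins⇒closedNbhd-fst-⊆ a~a′ N≡)
    (twins⇒closedNbhd-fst-⊆ (trans (Graph.sym G _ _) a~a′) (sym N≡))

  -- Every pair (c, snd u) is adjacent to v through H, hence lies in N_K[v] = N_K[u].
  twins⇒universal-fst : ∀ {u v} → adj H (snd u) (snd v) ≡ true →
    closedNbhd K u ≡ closedNbhd K v → Universal G (fst u)
  twins⇒universal-fst {u} {v} b~b′ N≡ c = ∈-closedNbhd-fibre (subst (pair c (snd u) ∈_) (sym N≡)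
    (∈-closedNbhd⁺ K (inj₂ (adj-snd (trans (cong (adj H (snd v)) (snd-pair c (snd u)))
                                            (trans (Graph.sym H _ _) b~b′))))))

  fromRows : (Fin (n G) → Subset (n H)) → Subset (n K)
  fromRows R = tabulate (λ z → lookup (R (fst z)) (snd z))

  ∈-fromRows⁻ : ∀ R {z} → z ∈ fromRows R → snd z ∈ R (fst z)
  ∈-fromRows⁻ R {z} z∈ = lookup⇒[]= (snd z) (R (fst z)) (∈-tabulate⁻ z∈)

  ∣fromRows∣ : ∀ R → ∣ fromRows R ∣ ≡ ∑[ a < n G ] ∣ R a ∣
  ∣fromRows∣ R = begin
    ∣ fromRows R ∣                                         ≡⟨ ∣tabulate∣≡∑ (λ z → lookup (R (fst z)) (snd z)) ⟩
    ∑[ z < n K ] indicator (lookup (R (fst z)) (snd z))   ≡⟨ ∑-pair _ ⟩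
    ∑[ a < n G ] ∑[ b < n H ] indicator (lookup (R (fst (pair a b))) (snd (pair a b)))
      ≡⟨ sum-cong-≗ (λ a → sum-cong-≗ λ b →
           cong₂ (λ x y → indicator (lookup (R x) y)) (fst-pair a b) (snd-pair a b)) ⟩
    ∑[ a < n G ] ∑[ b < n H ] indicator (lookup (R a) b)   ≡⟨ sum-cong-≗ (λ a → ∣p∣≡∑ (R a)) ⟨
    ∑[ a < n G ] ∣ R a ∣                                   ∎
    where open ≡-Reasoning

  record AdmissibleRow (X : Subset (n G)) (a : Fin (n G)) (Z : Subset (n H)) : Set where
    field
      ∈-base   : ∀ {b} → b ∈ Z → a ∈ X
      isClique : IsClique H Z
      edge⇒¬universal : ∀ {b b′} → b ∈ Z → b′ ∈ Z → adj H b b′ ≡ true → ¬ Universal G a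

  -- Vertices in different rows are separated through their G-coordinates, which are distinct
  -- elements of X; two vertices in one row are adjacent through H, so if they were twins their
  -- common G-coordinate would be universal.
  fromRows-isTwinsFreeClique : ∀ {X R} → IsTwinsFreeClique G X →
    (∀ a → AdmissibleRow X a (R a)) → IsTwinsFreeClique K (fromRows R)
  fromRows-isTwinsFreeClique {X} {R} (X-clique , X-twinsFree) admissible = clique , twinsFree
    where
    open module Row a = AdmissibleRow (admissible a)

    ∈X : ∀ {z} → z ∈ fromRows R → fst z ∈ X
    ∈X z∈ = ∈-base _ (∈-fromRows⁻ R z∈)

    sameRow-adj : ∀ {u v} → u ∈ fromRows R → v ∈ fromRows R → u ≢ v → fst u ≡ fst v →
                  adj H (snd u) (snd v) ≡ true
    sameRow-adj {u} {v} u∈ v∈ u≢v fst≡ = isClique (fst u) _ _ (∈-fromRows⁻ R u∈)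
      (subst (λ a → snd v ∈ R a) (sym fst≡) (∈-fromRows⁻ R v∈)) (snd-≢ u≢v fst≡)

    clique : IsClique K (fromRows R)
    clique u v u∈ v∈ u≢v with fst u ≟ fst v
    ... | yes fst≡ = adj-snd (sameRow-adj u∈ v∈ u≢v fst≡)
    ... | no  fst≢ = adj-fst (X-clique _ _ (∈X u∈) (∈X v∈) fst≢)

    twinsFree : ∀ u v → u ∈ fromRows R → v ∈ fromRows R → u ≢ v → closedNbhd K u ≢ closedNbhd K v
    twinsFree u v u∈ v∈ u≢v with fst u ≟ fst v
    ... | yes fst≡ = edge⇒¬universal (fst u) (∈-fromRows⁻ R u∈)
          (subst (λ a → snd v ∈ R a) (sym fst≡) (∈-fromRows⁻ R v∈)) b~b′
          ∘ twins⇒universal-fst b~b′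
      where
      b~b′ : adj H (snd u) (snd v) ≡ true
      b~b′ = sameRow-adj u∈ v∈ u≢v fst≡
    ... | no  fst≢ = X-twinsFree _ _ (∈X u∈) (∈X v∈) fst≢
          ∘ twins⇒twins-fst (X-clique _ _ (∈X u∈) (∈X v∈) fst≢)

  ⊗-admissible : ∀ {X Y} → IsClique H Y → ∀ a → (a ∈ X → ¬ Universal G a) →
                 AdmissibleRow X a ((X ⊗ Y) a)
  ⊗-admissible {X} {Y} Y-clique a a-nonUniv = record
    { ∈-base   = proj₁ ∘ ∈Y
    ; isClique = λ b b′ b∈ b′∈ → Y-clique b b′ (proj₂ (∈Y b∈)) (proj₂ (∈Y b′∈))
    ; edge⇒¬universal = λ b∈ _ _ → a-nonUniv (proj₁ (∈Y b∈))
    }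
    where
    ∈Y : ∀ {b} → b ∈ (X ⊗ Y) a → a ∈ X × b ∈ Y
    ∈Y = ∈-⊗⁻ {X = X}

  ⁅⁆-admissible : ∀ {X a} → a ∈ X → ∀ b → AdmissibleRow X a ⁅ b ⁆
  ⁅⁆-admissible a∈X b = record
    { ∈-base   = λ _ → a∈X
    ; isClique = ⁅⁆-isClique H b
    ; edge⇒¬universal = λ {b₁} b₁∈ b₂∈ b₁~b₂ _ → contradiction
        (trans (sym b₁~b₂) (trans (cong (adj H b₁) (∈⁅⁆-unique b₂∈ b₁∈)) (Graph.irrefl H b₁))) λ ()
    }

  ∣X∣*∣Y∣≤ϖ : ∀ {X Y m} → IsTwinsFreeClique G X → (∀ a → a ∈ X → ¬ Universal G a) →
              IsClique H Y → IsTwinsFreeCliqueNumber K m → ∣ X ∣ * ∣ Y ∣ ≤ m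
  ∣X∣*∣Y∣≤ϖ {X} {Y} X-tfc X-nonUniv Y-clique (_ , maximal) =
    subst (_≤ _) (trans (∣fromRows∣ (X ⊗ Y)) (∑-⊗ X Y))
      (maximal _ (fromRows-isTwinsFreeClique X-tfc λ a → ⊗-admissible Y-clique a (X-nonUniv a)))

  -- The rows of X × Y, except that the row of the (possibly universal) x₀ is cut down to one vertex.
  [∣X∣∸1]*∣Y∣+1≤ϖ : ∀ {X Y x₀ m} → IsTwinsFreeClique G X → x₀ ∈ X →
                     (∀ a → a ∈ X → a ≢ x₀ → ¬ Universal G a) → IsClique H Y → Fin (n H) →
                     IsTwinsFreeCliqueNumber K m → (∣ X ∣ ∸ 1) * ∣ Y ∣ + 1 ≤ m
  [∣X∣∸1]*∣Y∣+1≤ϖ {X} {Y} {x₀} {m} X-tfc x₀∈X others-nonUniv Y-clique y₀ (_ , maximal) =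
    subst (_≤ m) (w+s≡k*w+1⇒s≡[k∸1]*w+1 (≤-trans (s≤s z≤n) (x∈p⇒∣p-x∣<∣p∣ x₀∈X))
                   (trans (cong (∣ Y ∣ +_) (∣fromRows∣ R)) size))
      (maximal _ (fromRows-isTwinsFreeClique X-tfc admissible))
    where
    R : Fin (n G) → Subset (n H)
    R = updateAt (X ⊗ Y) x₀ (λ _ → ⁅ y₀ ⁆)

    admissible : ∀ a → AdmissibleRow X a (R a)
    admissible a with a ≟ x₀
    ... | yes refl = subst (AdmissibleRow X a) (sym (updateAt-updates a (X ⊗ Y))) (⁅⁆-admissible x₀∈X y₀)
    ... | no  a≢x₀ = subst (AdmissibleRow X a) (sym (updateAt-minimal a x₀ (X ⊗ Y) a≢x₀))
          (⊗-admissible Y-clique a λ a∈X → others-nonUniv a a∈X a≢x₀)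

    size : ∣ Y ∣ + ∑[ a < n G ] ∣ R a ∣ ≡ ∣ X ∣ * ∣ Y ∣ + 1
    size = begin
      ∣ Y ∣ + ∑[ a < n G ] ∣ R a ∣                  ≡⟨ cong (λ Z → ∣ Z ∣ + ∑[ a < n G ] ∣ R a ∣) (⊗-≡ {Y = Y} x₀∈X) ⟨
      ∣ (X ⊗ Y) x₀ ∣ + ∑[ a < n G ] ∣ R a ∣         ≡⟨ ∑-updateAt ∣_∣ (X ⊗ Y) x₀ ⁅ y₀ ⁆ ⟩
      ∑[ a < n G ] ∣ (X ⊗ Y) a ∣ + ∣ ⁅ y₀ ⁆ ∣       ≡⟨ cong₂ _+_ (∑-⊗ X Y) (∣⁅x⁆∣≡1 y₀) ⟩
      ∣ X ∣ * ∣ Y ∣ + 1                             ∎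
      where open ≡-Reasoning

  [ϖ∸1]*∣Y∣+1≤ϖ : ∀ {k Y m} → IsTwinsFreeCliqueNumber G k → Fin (n G) → IsClique H Y → Fin (n H) →
                  IsTwinsFreeCliqueNumber K m → (k ∸ 1) * ∣ Y ∣ + 1 ≤ m
  [ϖ∸1]*∣Y∣+1≤ϖ ϖ-def@((X , X-tfc , refl) , _) x Y-clique
    with nonUniversal-except-one G X-tfc (proj₂ (1≤∣p∣⇒Nonempty X (1≤ϖ G ϖ-def x)))
  ... | x₀ , x₀∈X , others-nonUniv = [∣X∣∸1]*∣Y∣+1≤ϖ X-tfc x₀∈X others-nonUniv Y-clique

nonTrivial⇒vertex : ∀ {G} → NonTrivial G → Fin (n G)
nonTrivial⇒vertex {G} _ with n G
... | suc _ = zero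

lemma5 : (G H : Graph) → NonTrivial G → NonTrivial H →
    (wG wH ϖG ϖH ϖGH : ℕ) →
    IsCliqueNumber G wG → IsCliqueNumber H wH →
    IsTwinsFreeCliqueNumber G ϖG → IsTwinsFreeCliqueNumber H ϖH →
    IsTwinsFreeCliqueNumber (G ⊕ H) ϖGH →
    (((ϖG ∸ 1) * wH) ⊔ ((ϖH ∸ 1) * wG)) + 1 ≤ ϖGH
    × (Σ (Subset (n G)) (λ X → IsTwinsFreeClique G X × ∣ X ∣ ≡ ϖG
          × (∀ v → v ∈ X → degree G v ≢ n G ∸ 1))
       → ϖG * wH ≤ ϖGH)
lemma5 G H G-nonTrivial H-nonTrivial wG wH ϖG ϖH ϖGH
       ((YG , YG-clique , refl) , _) ((YH , YH-clique , refl) , _) ϖG-def ϖH-def ϖGH-def =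
  subst (_≤ ϖGH) (sym (+-distribʳ-⊔ 1 ((ϖG ∸ 1) * ∣ YH ∣) ((ϖH ∸ 1) * ∣ YG ∣)))
    (⊔-lub (GH.[ϖ∸1]*∣Y∣+1≤ϖ ϖG-def x YH-clique y ϖGH-def)
           (HG.[ϖ∸1]*∣Y∣+1≤ϖ ϖH-def y YG-clique x ϖGH-def))
  , λ { (X , X-tfc , refl , X-degree) →
        GH.∣X∣*∣Y∣≤ϖ X-tfc (λ v v∈X → X-degree v v∈X ∘ universal⇒degree G v) YH-clique ϖGH-def }
  where
  module GH = CartesianSum (⊕-isCartesianSum G H)
  module HG = CartesianSum (IsCartesianSum-swap (⊕-isCartesianSum G H))

  x : Fin (n G)
  x = nonTrivial⇒vertex {G} G-nonTrivial
  y : Fin (n H)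
  y = nonTrivial⇒vertex {H} H-nonTrivial
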